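{- Let $m$ be an odd positive integer. Then $m$ is the smallest period of the sequence $\{t_n \bmod m\}_{n\ge0}$, i.e. $t_{n+m}\equiv t_n\pmod m$ for all $n\ge0$, and no positive integer $d<m$ satisfies $t_{n+d}\equiv t_n\pmod m$ for all $n\ge0$.
   Context: $t_n$ is the number of involutions of $[n]$ (permutations $\pi$ with $\pi^2=1$), with $t_0=1$. -}

module Defs where

open import Data.Nat using (ℕ; zero; suc)
open import Data.Fin using (Fin)
open import Data.Fin.Properties using (_≟_)
open import Data.Vec using (Vec; []; _∷_; lookup)
open import Data.List using (List; []; _∷_; concatMap; map; length; filter; allFin)
open import Data.List.Relation.Unary.All using (All)
open import Data.List.Relation.Unary.All using () renaming (all? to all?ᴸ)
open import Relation.Binary.PropositionalEquality using (_≡_)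
open import Relation.Nullary using (Dec)

allVecs : (n k : ℕ) → List (Vec (Fin n) k)
allVecs n zero = [] ∷ []
allVecs n (suc k) = concatMap (λ i → map (i ∷_) (allVecs n k)) (allFin n)

-- A map f : [n] → [n] (given as a vector of values) is an involution
-- iff f (f i) = i for all i.  (Such an f is automatically a permutation.)
IsInvolution : {n : ℕ} → Vec (Fin n) n → Set
IsInvolution {n} f = All (λ i → lookup f (lookup f i) ≡ i) (allFin n)

isInvolution? : {n : ℕ} → (f : Vec (Fin n) n) → Dec (IsInvolution f)
isInvolution? {n} f = all?ᴸ (λ i → lookup f (lookup f i) ≟ i) (allFin n)

t : ℕ → ℕ
t n = length (filter isInvolution? (allVecs n n))

-- The recurrence t (n + 2) = t (n + 1) + (n + 1) t n (the point 0 is either fixed or paired with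
-- one of the other n + 1 points) gives t n = Σₖ C(n, 2k) (2k − 1)!!.  For odd m every term with
-- k ≥ 1 is divisible by m: 2k C(m, 2k) = m C(m − 1, 2k − 1), so m divides C(m, 2k) gcd(2k, m),
-- and this gcd is odd and below 2k, hence a factor of (2k − 1)!!.  Thus modulo m, t m ≡ 1 = t 0
-- and t (m + 1) = t m + m t (m − 1) ≡ 1 = t 1, and the recurrence carries these congruences along.
-- Conversely, if d is a period then d + 2 = t 1 + (d + 1) t 0 ≡ t (d + 2) ≡ t 2 = 2, so m ∣ d.
module Submission where

open import Defs
open import Data.Nat using (ℕ; zero; suc; _+_; _*_; _≤_; _<_; z≤n; s≤s; NonZero; >-nonZero; _%_)
open import Data.Nat.Properties
  using ( +-suc; *-suc; *-comm; *-assoc; *-zeroʳ; *-identityˡ; *-identityʳ; +-*-semiring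
        ; ≤-trans; <-pred; n<1+n; m<n⇒m<1+n; m≤n⇒m<n∨m≡n; m≤m*n; *-cancelˡ-<; <⇒≱; even≢odd )
open import Data.Nat.Combinatorics using (_C_; nCk+nC[k+1]≡[n+1]C[k+1]; nC1≡n; k>n⇒nCk≡0)
open import Data.Nat.Divisibility
  using ( _∣_; divides; quotient; m∣n⇒n≡quotient*m; ∣-trans; _∣0; ∣m∣n⇒∣m+n
        ; n∣m*n; m∣m*n; *-monoʳ-∣; ∣⇒≤; m%n≡0⇒n∣m )
open import Data.Nat.DivMod using (%-distribˡ-+; %-distribˡ-*; %-remove-+ʳ; [m+n]%n≡m%n; [m+kn]%n≡m%n)
open import Data.Nat.GCD using (gcd; gcd-greatest; c*gcd[m,n]≡gcd[cm,cn]; gcd[m,n]∣m; gcd[m,n]∣n)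
open import Data.Nat.Tactic.RingSolver using (solve-∀)
open import Data.Fin using (Fin; zero; suc; toℕ; punchIn; punchOut; pinch)
open import Data.Fin.Properties
  using (_≟_; 0≢1+n; suc-injective; punchIn-injective; punchInᵢ≢i; punchIn-punchOut; punchOut-punchIn; punchOut-cong)
open import Data.Vec using (Vec; []; _∷_; lookup; map; tabulate; insertAt; removeAt)
open import Data.Vec.Properties
  using ( tabulate∘lookup; tabulate-cong; lookup-map; lookup∘tabulate; insertAt-lookup; insertAt-punchIn
        ; removeAt-insertAt; ∷-injective; ∷-injectiveˡ; ∷-injectiveʳ )
open import Data.Vec.Functional using (Vector; tail)
open import Algebra.Properties.Semiring.Sum +-*-semiring
  using (sum; sum-syntax; ∑-distrib-+; *-distribˡ-sum; sum-cong-≗; sum-replicate-zero)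
open import Data.List as List using (List; []; _∷_; _++_; length; filter; allFin; cartesianProductWith; concatMap)
open import Data.List.Properties using (length-++; length-map; length-tabulate)
open import Data.List.Membership.Propositional using (_∈_)
open import Data.List.Membership.Propositional.Properties
  using ( ∈-map⁺; ∈-map⁻; ∈-++⁺ˡ; ∈-++⁺ʳ; ∈-++⁻; ∈-cartesianProductWith⁺; ∈-cartesianProductWith⁻
        ; ∈-allFin; ∈-filter⁺; ∈-filter⁻ )
open import Data.List.Membership.Propositional.Properties.WithK using (unique∧set⇒bag)
open import Data.List.Relation.Unary.Any using (here)
open import Data.List.Relation.Unary.All using ([])
open import Data.List.Relation.Unary.All.Properties using (tabulate⁺; tabulate⁻)
open import Data.List.Relation.Unary.AllPairs using ([]; _∷_)
open import Data.List.Relation.Unary.Unique.Propositional using (Unique)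
import Data.List.Relation.Unary.Unique.Propositional.Properties as Unique
open import Data.List.Relation.Binary.BagAndSetEquality using (∼bag⇒↭)
open import Data.List.Relation.Binary.Permutation.Propositional.Properties using (↭-length)
open import Data.Product using (_×_; _,_; proj₁; proj₂; ∃-syntax)
open import Data.Sum using (_⊎_; inj₁; inj₂; [_,_]′)
open import Function using (_∘_)
open import Function.Bundles using (_⇔_; mk⇔)
open import Relation.Nullary using (¬_; yes; no; contradiction)
open import Relation.Binary.PropositionalEquality

-- Involutions and the recurrence

t′ : ℕ → ℕ
t′ zero = 1
t′ (suc zero) = 1
t′ (suc (suc n)) = t′ (suc n) + suc n * t′ n

Involutive : ∀ {n} → Vec (Fin n) n → Set
Involutive {n} f = ∀ i → lookup f (lookup f i) ≡ i

lookup-extensionality : ∀ {A : Set} {n} (f g : Vec A n) → (∀ i → lookup f i ≡ lookup g i) → f ≡ g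
lookup-extensionality f g f≗g = trans (sym (tabulate∘lookup f)) (trans (tabulate-cong f≗g) (tabulate∘lookup g))

fixZero : ∀ {n} → Vec (Fin (suc n)) (suc n) → Vec (Fin (2 + n)) (2 + n)
fixZero f = zero ∷ map suc f

skip : ∀ {n} → Fin (suc n) → Fin n → Fin (2 + n)
skip j k = suc (punchIn j k)

-- Left inverse of skip j; at 0 and suc j, which skip j misses, it returns the junk value d.
unskip : ∀ {n} → Fin (suc n) → Fin n → Fin (2 + n) → Fin n
unskip j d zero = d
unskip j d (suc y) with j ≟ y
... | yes _ = d
... | no j≢y = punchOut j≢y

unskip-skip : ∀ {n} j d (k : Fin n) → unskip j d (skip j k) ≡ k
unskip-skip j d k with j ≟ punchIn j k
... | yes j≡ = contradiction (sym j≡) (punchInᵢ≢i j k)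
... | no _ = trans (punchOut-cong j refl) (punchOut-punchIn j)

skip-unskip : ∀ {n} j d (x : Fin (2 + n)) → x ≢ zero → x ≢ suc j → skip j (unskip j d x) ≡ x
skip-unskip j d zero x≢0 _ = contradiction refl x≢0
skip-unskip j d (suc y) _ x≢1+j with j ≟ y
... | yes refl = contradiction refl x≢1+j
... | no j≢y = cong suc (punchIn-punchOut j≢y)

pairZeroWith : ∀ {n} → Fin (suc n) → Vec (Fin n) n → Vec (Fin (2 + n)) (2 + n)
pairZeroWith j g = suc j ∷ insertAt (map (skip j) g) j zero

lookup-pairZeroWith-skip : ∀ {n} j (g : Vec (Fin n) n) k → lookup (pairZeroWith j g) (skip j k) ≡ skip j (lookup g k)
lookup-pairZeroWith-skip j g k = trans (insertAt-punchIn (map (skip j) g) j zero k) (lookup-map k (skip j) g)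

lookup-pairZeroWith-partner : ∀ {n} j (g : Vec (Fin n) n) → lookup (pairZeroWith j g) (suc j) ≡ zero
lookup-pairZeroWith-partner j g = insertAt-lookup (map (skip j) g) j zero

fixZero-involutive : ∀ {n} {f : Vec (Fin (suc n)) (suc n)} → Involutive f → Involutive (fixZero f)
fixZero-involutive f-inv zero = refl
fixZero-involutive {f = f} f-inv (suc i) = begin
  lookup (fixZero f) (lookup (map suc f) i) ≡⟨ cong (lookup (fixZero f)) (lookup-map i suc f) ⟩
  lookup (map suc f) (lookup f i)           ≡⟨ lookup-map (lookup f i) suc f ⟩
  suc (lookup f (lookup f i))               ≡⟨ cong suc (f-inv i) ⟩
  suc i                                     ∎
  where open ≡-Reasoning

skip-cover : ∀ {A : Set} {n} j {φ ψ : Fin (2 + n) → A} → φ zero ≡ ψ zero → φ (suc j) ≡ ψ (suc j) →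
             (∀ k → φ (skip j k) ≡ ψ (skip j k)) → ∀ x → φ x ≡ ψ x
skip-cover j φ0≡ψ0 _ _ zero = φ0≡ψ0
skip-cover j _ _ _ (suc y) with j ≟ y
skip-cover j _ φj≡ψj _ (suc y) | yes refl = φj≡ψj
skip-cover j {φ} {ψ} _ _ φskip≡ψskip (suc y) | no j≢y =
  subst (λ x → φ x ≡ ψ x) (cong suc (punchIn-punchOut j≢y)) (φskip≡ψskip (punchOut j≢y))

pairZeroWith-involutive : ∀ {n} j {g : Vec (Fin n) n} → Involutive g → Involutive (pairZeroWith j g)
pairZeroWith-involutive j {g} g-inv = skip-cover j
  (lookup-pairZeroWith-partner j g)
  (cong (lookup h) (lookup-pairZeroWith-partner j g))
  on-skip
  where
  h = pairZeroWith j g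
  on-skip : ∀ k → lookup h (lookup h (skip j k)) ≡ skip j k
  on-skip k = begin
    lookup h (lookup h (skip j k))  ≡⟨ cong (lookup h) (lookup-pairZeroWith-skip j g k) ⟩
    lookup h (skip j (lookup g k))  ≡⟨ lookup-pairZeroWith-skip j g (lookup g k) ⟩
    skip j (lookup g (lookup g k))  ≡⟨ cong (skip j) (g-inv k) ⟩
    skip j k                        ∎
    where open ≡-Reasoning

involutions : (n : ℕ) → List (Vec (Fin n) n)
involutions zero = [] ∷ []
involutions (suc zero) = (zero ∷ []) ∷ []
involutions (suc (suc n)) =
  List.map fixZero (involutions (suc n)) ++ cartesianProductWith pairZeroWith (allFin (suc n)) (involutions n)

length-cartesianProductWith : ∀ {A B C : Set} (f : A → B → C) xs ys →
                              length (cartesianProductWith f xs ys) ≡ length xs * length ys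
length-cartesianProductWith f [] ys = refl
length-cartesianProductWith f (x ∷ xs) ys =
  trans (length-++ (List.map (f x) ys)) (cong₂ _+_ (length-map (f x) ys) (length-cartesianProductWith f xs ys))

length-involutions : ∀ n → length (involutions n) ≡ t′ n
length-involutions zero = refl
length-involutions (suc zero) = refl
length-involutions (suc (suc n)) = begin
  length (fixed ++ paired)
    ≡⟨ length-++ fixed ⟩
  length fixed + length paired
    ≡⟨ cong₂ _+_ (length-map fixZero I₁) (length-cartesianProductWith pairZeroWith (allFin (suc n)) I₀) ⟩
  length I₁ + length (allFin (suc n)) * length I₀
    ≡⟨ cong₂ (λ x y → x + y * length I₀) (length-involutions (suc n)) (length-tabulate {n = suc n} (λ i → i)) ⟩
  t′ (suc n) + suc n * length I₀
    ≡⟨ cong (λ x → t′ (suc n) + suc n * x) (length-involutions n) ⟩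
  t′ (suc (suc n))
    ∎
  where
  open ≡-Reasoning
  I₁ = involutions (suc n)
  I₀ = involutions n
  fixed = List.map fixZero I₁
  paired = cartesianProductWith pairZeroWith (allFin (suc n)) I₀

∈-involutions⁻ : ∀ {n f} → f ∈ involutions (2 + n) →
                 (∃[ g ] g ∈ involutions (suc n) × f ≡ fixZero g)
                 ⊎ (∃[ j ] ∃[ g ] j ∈ allFin (suc n) × g ∈ involutions n × f ≡ pairZeroWith j g)
∈-involutions⁻ {n} f∈ with ∈-++⁻ (List.map fixZero (involutions (suc n))) f∈
... | inj₁ f∈fixed = inj₁ (∈-map⁻ fixZero f∈fixed)
... | inj₂ f∈paired = inj₂ (∈-cartesianProductWith⁻ pairZeroWith (allFin (suc n)) (involutions n) f∈paired)

-- Case analysis goes through [_,_]′ because with-clauses would hide the decrease from 2 + n to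
-- 1 + n from the termination checker (here and in involutions-complete).
involutions-involutive : ∀ n {f} → f ∈ involutions n → Involutive f
involutions-involutive zero (here refl) ()
involutions-involutive (suc zero) (here refl) zero = refl
involutions-involutive (suc (suc n)) f∈ =
  [ (λ (g , g∈ , f≡) → subst Involutive (sym f≡) (fixZero-involutive (involutions-involutive (suc n) g∈)))
  , (λ (j , g , _ , g∈ , f≡) → subst Involutive (sym f≡) (pairZeroWith-involutive j (involutions-involutive n g∈)))
  ]′ (∈-involutions⁻ f∈)

suc-pinch-zero : ∀ {n} {x : Fin (2 + n)} → x ≢ zero → suc (pinch zero x) ≡ x
suc-pinch-zero {x = zero} x≢0 = contradiction refl x≢0
suc-pinch-zero {x = suc y} _ = refl

fixZero-surjective : ∀ {n} {f : Vec (Fin (2 + n)) (2 + n)} → Involutive f → lookup f zero ≡ zero →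
                     ∃[ g ] Involutive g × fixZero g ≡ f
fixZero-surjective {n} {f₀ ∷ fs} f-inv f₀≡0 = g , g-inv , lookup-extensionality (fixZero g) (f₀ ∷ fs) fixZero-g≗f
  where
  f = f₀ ∷ fs
  g = map (pinch zero) fs
  fs-nonzero : ∀ i → lookup fs i ≢ zero
  fs-nonzero i fs[i]≡0 = 0≢1+n (begin
    zero                      ≡⟨ f₀≡0 ⟨
    lookup f zero             ≡⟨ cong (lookup f) fs[i]≡0 ⟨
    lookup f (lookup fs i)    ≡⟨ f-inv (suc i) ⟩
    suc i                     ∎)
    where open ≡-Reasoning
  suc-g : ∀ i → suc (lookup g i) ≡ lookup fs i
  suc-g i = trans (cong suc (lookup-map i (pinch zero) fs)) (suc-pinch-zero (fs-nonzero i))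
  g-inv : Involutive g
  g-inv i = begin
    lookup g (lookup g i)                    ≡⟨ lookup-map (lookup g i) (pinch zero) fs ⟩
    pinch zero (lookup f (suc (lookup g i))) ≡⟨ cong (pinch zero ∘ lookup f) (suc-g i) ⟩
    pinch zero (lookup f (lookup f (suc i))) ≡⟨ cong (pinch zero) (f-inv (suc i)) ⟩
    i                                        ∎
    where open ≡-Reasoning
  fixZero-g≗f : ∀ i → lookup (fixZero g) i ≡ lookup f i
  fixZero-g≗f zero = sym f₀≡0
  fixZero-g≗f (suc i) = trans (lookup-map i suc g) (suc-g i)

pairZeroWith-surjective : ∀ {n j} {f : Vec (Fin (2 + n)) (2 + n)} → Involutive f → lookup f zero ≡ suc j →
                          ∃[ g ] Involutive g × pairZeroWith j g ≡ f
pairZeroWith-surjective {n} {j} {f} f-inv f0≡1+j = g , g-inv , lookup-extensionality (pairZeroWith j g) f pairZeroWith-g≗f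
  where
  f[1+j]≡0 : lookup f (suc j) ≡ zero
  f[1+j]≡0 = trans (cong (lookup f) (sym f0≡1+j)) (f-inv zero)
  f-skip : Fin n → Fin (2 + n)
  f-skip k = lookup f (skip j k)
  f-skip≢0 : ∀ k → f-skip k ≢ zero
  f-skip≢0 k f-skip≡0 = punchInᵢ≢i j k (suc-injective (begin
    skip j k                  ≡⟨ f-inv (skip j k) ⟨
    lookup f (f-skip k)       ≡⟨ cong (lookup f) f-skip≡0 ⟩
    lookup f zero             ≡⟨ f0≡1+j ⟩
    suc j                     ∎))
    where open ≡-Reasoning
  f-skip≢1+j : ∀ k → f-skip k ≢ suc j
  f-skip≢1+j k f-skip≡1+j = 0≢1+n (begin
    zero                      ≡⟨ f[1+j]≡0 ⟨
    lookup f (suc j)          ≡⟨ cong (lookup f) f-skip≡1+j ⟨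
    lookup f (f-skip k)       ≡⟨ f-inv (skip j k) ⟩
    skip j k                  ∎)
    where open ≡-Reasoning
  g = tabulate (λ k → unskip j k (f-skip k))
  skip-g : ∀ k → skip j (lookup g k) ≡ f-skip k
  skip-g k = trans (cong (skip j) (lookup∘tabulate (λ k → unskip j k (f-skip k)) k))
                   (skip-unskip j k (f-skip k) (f-skip≢0 k) (f-skip≢1+j k))
  g-inv : Involutive g
  g-inv k = begin
    lookup g (lookup g k)                        ≡⟨ lookup∘tabulate (λ k → unskip j k (f-skip k)) (lookup g k) ⟩
    unskip j (lookup g k) (f-skip (lookup g k))  ≡⟨ cong (unskip j (lookup g k) ∘ lookup f) (skip-g k) ⟩
    unskip j (lookup g k) (lookup f (f-skip k))  ≡⟨ cong (unskip j (lookup g k)) (f-inv (skip j k)) ⟩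
    unskip j (lookup g k) (skip j k)             ≡⟨ unskip-skip j (lookup g k) k ⟩
    k                                            ∎
    where open ≡-Reasoning
  pairZeroWith-g≗f : ∀ x → lookup (pairZeroWith j g) x ≡ lookup f x
  pairZeroWith-g≗f = skip-cover j (sym f0≡1+j) (trans (lookup-pairZeroWith-partner j g) (sym f[1+j]≡0))
                                 (λ k → trans (lookup-pairZeroWith-skip j g k) (skip-g k))

involutive-decomposition : ∀ {n} {f : Vec (Fin (2 + n)) (2 + n)} → Involutive f →
                           (∃[ g ] Involutive g × fixZero g ≡ f)
                           ⊎ (∃[ j ] ∃[ g ] Involutive g × pairZeroWith j g ≡ f)
involutive-decomposition {f = f} f-inv with lookup f zero in f0≡
... | zero = inj₁ (fixZero-surjective f-inv f0≡)
... | suc j = inj₂ (j , pairZeroWith-surjective f-inv f0≡)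

involutions-complete : ∀ n {f} → Involutive f → f ∈ involutions n
involutions-complete zero {[]} _ = here refl
involutions-complete (suc zero) {zero ∷ []} _ = here refl
involutions-complete (suc (suc n)) f-inv =
  [ (λ (g , g-inv , f≡) → subst (_∈ involutions (2 + n)) f≡
                            (∈-++⁺ˡ (∈-map⁺ fixZero (involutions-complete (suc n) g-inv))))
  , (λ (j , g , g-inv , f≡) → subst (_∈ involutions (2 + n)) f≡
                            (∈-++⁺ʳ (List.map fixZero (involutions (suc n)))
                              (∈-cartesianProductWith⁺ pairZeroWith (∈-allFin j) (involutions-complete n g-inv))))
  ]′ (involutive-decomposition f-inv)

map-injective : ∀ {A B : Set} {n} {φ : A → B} → (∀ {x y} → φ x ≡ φ y → x ≡ y) →
                ∀ {xs ys : Vec A n} → map φ xs ≡ map φ ys → xs ≡ ys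
map-injective φ-inj {[]} {[]} _ = refl
map-injective φ-inj {x ∷ xs} {y ∷ ys} eq =
  cong₂ _∷_ (φ-inj (∷-injectiveˡ eq)) (map-injective φ-inj (∷-injectiveʳ eq))

fixZero-injective : ∀ {n} {a b : Vec (Fin (suc n)) (suc n)} → fixZero a ≡ fixZero b → a ≡ b
fixZero-injective eq = map-injective suc-injective (∷-injectiveʳ eq)

pairZeroWith-injective : ∀ {n} {j j′ : Fin (suc n)} {a b : Vec (Fin n) n} →
                         pairZeroWith j a ≡ pairZeroWith j′ b → j ≡ j′ × a ≡ b
pairZeroWith-injective {j = j} {a = a} {b} eq with refl ← suc-injective (∷-injectiveˡ eq) =
  refl , map-injective (punchIn-injective j _ _ ∘ suc-injective) (begin
    map (skip j) a                                        ≡⟨ removeAt-insertAt (map (skip j) a) j zero ⟨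
    removeAt (insertAt (map (skip j) a) j zero) j         ≡⟨ cong (λ v → removeAt v j) (∷-injectiveʳ eq) ⟩
    removeAt (insertAt (map (skip j) b) j zero) j         ≡⟨ removeAt-insertAt (map (skip j) b) j zero ⟩
    map (skip j) b                                        ∎)
  where open ≡-Reasoning

involutions-unique : ∀ n → Unique (involutions n)
involutions-unique zero = [] ∷ []
involutions-unique (suc zero) = [] ∷ []
involutions-unique (suc (suc n)) =
  Unique.++⁺ (Unique.map⁺ fixZero-injective (involutions-unique (suc n)))
             (Unique.cartesianProductWith⁺ pairZeroWith pairZeroWith-injective
                                           (Unique.allFin⁺ (suc n)) (involutions-unique n))
             fixed-and-paired-disjoint
  where
  fixed-and-paired-disjoint : ∀ {v} → ¬ (v ∈ List.map fixZero (involutions (suc n))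
                                         × v ∈ cartesianProductWith pairZeroWith (allFin (suc n)) (involutions n))
  fixed-and-paired-disjoint (v∈fixed , v∈paired)
    with _ , _ , refl ← ∈-map⁻ fixZero v∈fixed
    with _ , _ , _ , _ , () ← ∈-cartesianProductWith⁻ pairZeroWith (allFin (suc n)) (involutions n) v∈paired

concatMap-map≡cartesianProductWith : ∀ {A B C : Set} (f : A → B → C) xs ys →
                                     concatMap (λ x → List.map (f x) ys) xs ≡ cartesianProductWith f xs ys
concatMap-map≡cartesianProductWith f [] ys = refl
concatMap-map≡cartesianProductWith f (x ∷ xs) ys = cong (List.map (f x) ys ++_) (concatMap-map≡cartesianProductWith f xs ys)

allVecs-unique : ∀ n k → Unique (allVecs n k)
allVecs-unique n zero = [] ∷ []
allVecs-unique n (suc k) = subst Unique (sym (concatMap-map≡cartesianProductWith _∷_ (allFin n) (allVecs n k)))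
  (Unique.cartesianProductWith⁺ _∷_ ∷-injective (Unique.allFin⁺ n) (allVecs-unique n k))

∈-allVecs : ∀ n k (v : Vec (Fin n) k) → v ∈ allVecs n k
∈-allVecs n zero [] = here refl
∈-allVecs n (suc k) (x ∷ v) = subst (x ∷ v ∈_) (sym (concatMap-map≡cartesianProductWith _∷_ (allFin n) (allVecs n k)))
  (∈-cartesianProductWith⁺ _∷_ (∈-allFin x) (∈-allVecs n k v))

t≡t′ : ∀ n → t n ≡ t′ n
t≡t′ n = trans (↭-length (∼bag⇒↭ (unique∧set⇒bag filtered-unique (involutions-unique n) same-members)))
               (length-involutions n)
  where
  filtered-unique : Unique (filter isInvolution? (allVecs n n))
  filtered-unique = Unique.filter⁺ isInvolution? (allVecs-unique n n)
  -- IsInvolution f is an All over allFin n = tabulate id.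
  same-members : ∀ {f} → f ∈ filter isInvolution? (allVecs n n) ⇔ f ∈ involutions n
  same-members {f} = mk⇔
    (λ f∈ → involutions-complete n (tabulate⁻ (proj₂ (∈-filter⁻ isInvolution? {xs = allVecs n n} f∈))))
    (λ f∈ → ∈-filter⁺ isInvolution? (∈-allVecs n n f) (tabulate⁺ (involutions-involutive n f∈)))

-- The sum formula

[k+1]*[n+1]C[k+1]≡[n+1]*nCk : ∀ n k → suc k * (suc n C suc k) ≡ suc n * (n C k)
[k+1]*[n+1]C[k+1]≡[n+1]*nCk zero zero = refl
[k+1]*[n+1]C[k+1]≡[n+1]*nCk zero (suc k) = begin
  suc (suc k) * (1 C suc (suc k)) ≡⟨ cong (suc (suc k) *_) (k>n⇒nCk≡0 {1} {suc (suc k)} (s≤s (s≤s z≤n))) ⟩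
  suc (suc k) * 0                 ≡⟨ *-zeroʳ (suc (suc k)) ⟩
  0                               ≡⟨ cong (1 *_) (k>n⇒nCk≡0 {0} {suc k} (s≤s z≤n)) ⟨
  1 * (0 C suc k)                 ∎
  where open ≡-Reasoning
[k+1]*[n+1]C[k+1]≡[n+1]*nCk (suc n) zero = begin
  1 * (suc (suc n) C 1) ≡⟨ *-identityˡ _ ⟩
  suc (suc n) C 1       ≡⟨ nC1≡n (suc (suc n)) ⟩
  suc (suc n)           ≡⟨ *-identityʳ (suc (suc n)) ⟨
  suc (suc n) * 1       ∎
  where open ≡-Reasoning
[k+1]*[n+1]C[k+1]≡[n+1]*nCk (suc n) (suc k) = begin
  (2 + k) * ((2 + n) C (2 + k))
    ≡⟨ cong ((2 + k) *_) (nCk+nC[k+1]≡[n+1]C[k+1] (suc n) (suc k)) ⟨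
  (2 + k) * ((1 + n) C (1 + k) + (1 + n) C (2 + k))
    ≡⟨ split k ((1 + n) C (1 + k)) ((1 + n) C (2 + k)) ⟩
  (1 + n) C (1 + k) + (1 + k) * ((1 + n) C (1 + k)) + (2 + k) * ((1 + n) C (2 + k))
    ≡⟨ cong₂ (λ x y → (1 + n) C (1 + k) + x + y)
             ([k+1]*[n+1]C[k+1]≡[n+1]*nCk n k) ([k+1]*[n+1]C[k+1]≡[n+1]*nCk n (suc k)) ⟩
  (1 + n) C (1 + k) + (1 + n) * (n C k) + (1 + n) * (n C (1 + k))
    ≡⟨ merge n ((1 + n) C (1 + k)) (n C k) (n C (1 + k)) ⟩
  (1 + n) C (1 + k) + (1 + n) * (n C k + n C (1 + k))
    ≡⟨ cong (λ x → (1 + n) C (1 + k) + (1 + n) * x) (nCk+nC[k+1]≡[n+1]C[k+1] n k) ⟩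
  (2 + n) * ((1 + n) C (1 + k))
    ∎
  where
  open ≡-Reasoning
  split : ∀ k a b → (2 + k) * (a + b) ≡ a + (1 + k) * a + (2 + k) * b
  split = solve-∀
  merge : ∀ n a b c → a + (1 + n) * b + (1 + n) * c ≡ a + (1 + n) * (b + c)
  merge = solve-∀

oddFactorial : ℕ → ℕ
oddFactorial zero = 1
oddFactorial (suc k) = suc (2 * k) * oddFactorial k

-- The number of involutions of Fin n with exactly k two-cycles.
matchings : ℕ → ℕ → ℕ
matchings n k = (n C (2 * k)) * oddFactorial k

matchings-rec : ∀ n k → matchings (2 + n) (suc k) ≡ matchings (suc n) (suc k) + suc n * matchings n k
matchings-rec n k = begin
  ((2 + n) C (2 * suc k)) * (e * f)
    ≡⟨ cong (λ i → ((2 + n) C i) * (e * f)) 2[1+k]≡1+e ⟩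
  ((2 + n) C suc e) * (e * f)
    ≡⟨ cong (_* (e * f)) (nCk+nC[k+1]≡[n+1]C[k+1] (suc n) e) ⟨
  ((1 + n) C e + (1 + n) C suc e) * (e * f)
    ≡⟨ rearrange ((1 + n) C e) ((1 + n) C suc e) e f ⟩
  ((1 + n) C suc e) * (e * f) + (e * ((1 + n) C e)) * f
    ≡⟨ cong₂ (λ i x → ((1 + n) C i) * (e * f) + x * f)
             (sym 2[1+k]≡1+e) ([k+1]*[n+1]C[k+1]≡[n+1]*nCk n (2 * k)) ⟩
  ((1 + n) C (2 * suc k)) * (e * f) + ((1 + n) * (n C (2 * k))) * f
    ≡⟨ cong (matchings (suc n) (suc k) +_) (*-assoc (1 + n) (n C (2 * k)) f) ⟩
  matchings (suc n) (suc k) + suc n * matchings n k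
    ∎
  where
  open ≡-Reasoning
  e = suc (2 * k)
  f = oddFactorial k
  2[1+k]≡1+e : 2 * suc k ≡ suc e
  2[1+k]≡1+e = *-suc 2 k
  rearrange : ∀ a b e f → (a + b) * (e * f) ≡ b * (e * f) + (e * a) * f
  rearrange = solve-∀

matchings-vanish : ∀ {n k} → n < 2 * k → matchings n k ≡ 0
matchings-vanish {k = k} n<2k = cong (_* oddFactorial k) (k>n⇒nCk≡0 n<2k)

∑matchings[1+k]≡0 : ∀ {n} B → n < 2 → ∑[ k < B ] matchings n (suc (toℕ k)) ≡ 0
∑matchings[1+k]≡0 {n} B n<2 =
  trans (sum-cong-≗ {B} (λ k → matchings-vanish {n} {suc (toℕ k)} (≤-trans n<2 (m≤m*n 2 (suc (toℕ k))))))
        (sum-replicate-zero B)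

t′≡∑matchings : ∀ {n B} → n < B → t′ n ≡ ∑[ k < B ] matchings n (toℕ k)
t′≡∑matchings {zero} {suc B} _ = cong suc (sym (∑matchings[1+k]≡0 B (s≤s z≤n)))
t′≡∑matchings {suc zero} {suc B} _ = cong suc (sym (∑matchings[1+k]≡0 B (s≤s (s≤s z≤n))))
t′≡∑matchings {suc (suc n)} {suc B} (s≤s 1+n<B) = begin
  t′ (suc n) + suc n * t′ n
    ≡⟨ cong₂ (λ x y → x + suc n * y) (t′≡∑matchings (m<n⇒m<1+n 1+n<B))
                                      (t′≡∑matchings (<-pred (m<n⇒m<1+n 1+n<B))) ⟩
  ∑[ k < suc B ] matchings (suc n) (toℕ k) + suc n * sum M₀
    ≡⟨ cong (λ x → ∑[ k < suc B ] matchings (suc n) (toℕ k) + x) (*-distribˡ-sum {B} (suc n) M₀) ⟩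
  1 + sum M₁ + ∑[ k < B ] (suc n * M₀ k)
    ≡⟨ cong suc (∑-distrib-+ {B} M₁ (λ k → suc n * M₀ k)) ⟨
  1 + ∑[ k < B ] (M₁ k + suc n * M₀ k)
    ≡⟨ cong suc (sum-cong-≗ {B} (λ k → sym (matchings-rec n (toℕ k)))) ⟩
  ∑[ k < suc B ] matchings (2 + n) (toℕ k)
    ∎
  where
  open ≡-Reasoning
  M₀ M₁ : Vector ℕ B
  M₀ k = matchings n (toℕ k)
  M₁ k = matchings (suc n) (suc (toℕ k))

-- Divisibility by odd m

even⊎odd : ∀ n → (∃[ i ] n ≡ 2 * i) ⊎ (∃[ i ] n ≡ suc (2 * i))
even⊎odd zero = inj₁ (0 , refl)
even⊎odd (suc n) with even⊎odd n
... | inj₁ (i , refl) = inj₂ (i , refl)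
... | inj₂ (i , refl) = inj₁ (suc i , cong suc (sym (+-suc i (i + 0))))

∣odd⇒odd : ∀ {d k} → d ∣ suc (2 * k) → ∃[ i ] d ≡ suc (2 * i)
∣odd⇒odd {d} {k} d∣m with even⊎odd d
... | inj₂ d-odd = d-odd
... | inj₁ (i , refl) with divides q eq ← d∣m =
  contradiction (trans (swap q i) (sym eq)) (even≢odd (q * i) k)
  where
  swap : ∀ q i → 2 * (q * i) ≡ q * (2 * i)
  swap = solve-∀

odd∣oddFactorial : ∀ {i k} → i < k → suc (2 * i) ∣ oddFactorial k
odd∣oddFactorial {i} {suc k} (s≤s i≤k) with m≤n⇒m<n∨m≡n i≤k
... | inj₁ i<k = ∣-trans (odd∣oddFactorial i<k) (n∣m*n (suc (2 * k)))
... | inj₂ refl = m∣m*n (oddFactorial k)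

∣-*-gcd : ∀ {m a b} → m ∣ a * b → m ∣ a * gcd b m
∣-*-gcd {m} {a} {b} m∣ab =
  subst (m ∣_) (sym (c*gcd[m,n]≡gcd[cm,cn] a b m)) (gcd-greatest m∣ab (n∣m*n a))

odd∣matchings[1+j] : ∀ k j → suc (2 * k) ∣ matchings (suc (2 * k)) (suc j)
odd∣matchings[1+j] k j = ∣-trans m∣X*g (*-monoʳ-∣ X g∣oddFactorial)
  where
  m = suc (2 * k)
  e = 2 * suc j
  X = m C e
  g = gcd e m
  Y = (2 * k) C suc (2 * j)
  m∣X*e : m ∣ X * e
  m∣X*e = divides Y (begin
    X * e  ≡⟨ *-comm X e ⟩
    e * X  ≡⟨ subst (λ i → i * (m C i) ≡ m * Y) (sym (*-suc 2 j))
                    ([k+1]*[n+1]C[k+1]≡[n+1]*nCk (2 * k) (suc (2 * j))) ⟩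
    m * Y  ≡⟨ *-comm m Y ⟩
    Y * m  ∎)
    where open ≡-Reasoning
  m∣X*g : m ∣ X * g
  m∣X*g = ∣-*-gcd {m} {X} {e} m∣X*e
  g∣oddFactorial : g ∣ oddFactorial (suc j)
  g∣oddFactorial with i , g≡1+2i ← ∣odd⇒odd {g} {k} (gcd[m,n]∣n e m) =
    subst (_∣ oddFactorial (suc j)) (sym g≡1+2i)
      (odd∣oddFactorial (*-cancelˡ-< 2 i (suc j) (subst (_≤ e) g≡1+2i (∣⇒≤ (gcd[m,n]∣m e m)))))

∣-sum : ∀ {d} n (f : Vector ℕ n) → (∀ i → d ∣ f i) → d ∣ sum f
∣-sum {d} zero f _ = d ∣0
∣-sum (suc n) f d∣f = ∣m∣n⇒∣m+n (d∣f _) (∣-sum n (tail f) (λ i → d∣f (suc i)))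

t′[1+2k]%[1+2k]≡1 : ∀ k → t′ (suc (2 * k)) % suc (2 * k) ≡ 1 % suc (2 * k)
t′[1+2k]%[1+2k]≡1 k = begin
  t′ m % m                                       ≡⟨ cong (_% m) (t′≡∑matchings (n<1+n m)) ⟩
  (1 + ∑[ i < m ] matchings m (suc (toℕ i))) % m ≡⟨ cong (λ x → suc x % m) (m∣n⇒n≡quotient*m m∣rest) ⟩
  (1 + quotient m∣rest * m) % m                  ≡⟨ [m+kn]%n≡m%n 1 (quotient m∣rest) m ⟩
  1 % m                                          ∎
  where
  open ≡-Reasoning
  m = suc (2 * k)
  m∣rest : m ∣ ∑[ i < m ] matchings m (suc (toℕ i))
  m∣rest = ∣-sum m (λ i → matchings m (suc (toℕ i))) (λ i → odd∣matchings[1+j] k (toℕ i))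

-- Residues modulo m

%-cong-+ : ∀ {m} .{{_ : NonZero m}} {a a′ b b′} →
           a % m ≡ a′ % m → b % m ≡ b′ % m → (a + b) % m ≡ (a′ + b′) % m
%-cong-+ {m} {a} {a′} {b} {b′} a≡a′ b≡b′ = begin
  (a + b) % m               ≡⟨ %-distribˡ-+ a b m ⟩
  (a % m + b % m) % m       ≡⟨ cong₂ (λ x y → (x + y) % m) a≡a′ b≡b′ ⟩
  (a′ % m + b′ % m) % m     ≡⟨ %-distribˡ-+ a′ b′ m ⟨
  (a′ + b′) % m             ∎
  where open ≡-Reasoning

%-cong-* : ∀ {m} .{{_ : NonZero m}} {a a′ b b′} →
           a % m ≡ a′ % m → b % m ≡ b′ % m → (a * b) % m ≡ (a′ * b′) % m
%-cong-* {m} {a} {a′} {b} {b′} a≡a′ b≡b′ = begin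
  (a * b) % m               ≡⟨ %-distribˡ-* a b m ⟩
  (a % m * (b % m)) % m     ≡⟨ cong₂ (λ x y → (x * y) % m) a≡a′ b≡b′ ⟩
  (a′ % m * (b′ % m)) % m   ≡⟨ %-distribˡ-* a′ b′ m ⟨
  (a′ * b′) % m             ∎
  where open ≡-Reasoning

%-cancelˡ-+ : ∀ {m} .{{_ : NonZero m}} a {b c} → (a + b) % m ≡ (a + c) % m → b % m ≡ c % m
%-cancelˡ-+ {suc m} a {b} {c} a+b≡a+c = begin
  b % suc m                       ≡⟨ [m+kn]%n≡m%n b a (suc m) ⟨
  (b + a * suc m) % suc m         ≡⟨ cong (_% suc m) (shift a b m) ⟩
  (a * m + (a + b)) % suc m       ≡⟨ %-cong-+ {a = a * m} {a * m} {a + b} {a + c} refl a+b≡a+c ⟩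
  (a * m + (a + c)) % suc m       ≡⟨ cong (_% suc m) (shift a c m) ⟨
  (c + a * suc m) % suc m         ≡⟨ [m+kn]%n≡m%n c a (suc m) ⟩
  c % suc m                       ∎
  where
  open ≡-Reasoning
  shift : ∀ a b m → b + a * suc m ≡ a * m + (a + b)
  shift = solve-∀

t′-periodic : ∀ {m} .{{_ : NonZero m}} → t′ m % m ≡ 1 % m → ∀ n → t′ (n + m) % m ≡ t′ n % m
t′-periodic {suc N} t′[m]≡1 n = proj₁ (consecutive n)
  where
  m = suc N
  Periodic-at : ℕ → Set
  Periodic-at n = t′ (n + m) % m ≡ t′ n % m
  consecutive : ∀ n → Periodic-at n × Periodic-at (suc n)
  consecutive zero = t′[m]≡1 , trans (%-remove-+ʳ (t′ m) (m∣m*n (t′ N))) t′[m]≡1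
  consecutive (suc n) with consecutive n
  ... | at-n , at-1+n = at-1+n , %-cong-+ {a = t′ (suc (n + m))} {t′ (suc n)} at-1+n
                                 (%-cong-* {a = suc (n + m)} {suc n} {t′ (n + m)} {t′ n} ([m+n]%n≡m%n (suc n) m) at-n)

t′-aperiodic : ∀ {m d} .{{_ : NonZero m}} → 0 < d → d < m → ¬ (∀ n → t′ (n + d) % m ≡ t′ n % m)
t′-aperiodic {m@(suc _)} {d} 0<d d<m periodic = <⇒≱ d<m (∣⇒≤ {{>-nonZero 0<d}} (m%n≡0⇒n∣m d m d%m≡0))
  where
  open ≡-Reasoning
  2+d≡2 : (2 + d) % m ≡ 2 % m
  2+d≡2 = begin
    (2 + d) % m
      ≡⟨ cong (λ x → (1 + x) % m) (*-identityʳ (1 + d)) ⟨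
    (1 + (1 + d) * 1) % m
      ≡⟨ %-cong-+ {a = t′ (1 + d)} {1} (periodic 1) (%-cong-* {a = 1 + d} {1 + d} {t′ d} {1} refl (periodic 0)) ⟨
    t′ (2 + d) % m
      ≡⟨ periodic 2 ⟩
    2 % m
      ∎
  d%m≡0 : d % m ≡ 0
  d%m≡0 = %-cancelˡ-+ 2 {d} {0} 2+d≡2

theorem6p2 : (k : ℕ) → let m = suc (2 * k) in
    ((n : ℕ) → t (n + m) % m ≡ t n % m)
    × ((d : ℕ) → 0 < d → d < m → ¬ ((n : ℕ) → t (n + d) % m ≡ t n % m))
theorem6p2 k = periodic , aperiodic
  where
  m = suc (2 * k)
  periodic : (n : ℕ) → t (n + m) % m ≡ t n % m
  periodic n rewrite t≡t′ (n + m) | t≡t′ n = t′-periodic (t′[1+2k]%[1+2k]≡1 k) n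
  aperiodic : (d : ℕ) → 0 < d → d < m → ¬ ((n : ℕ) → t (n + d) % m ≡ t n % m)
  aperiodic d 0<d d<m t-periodic = t′-aperiodic 0<d d<m t′-periodic-d
    where
    t′-periodic-d : (n : ℕ) → t′ (n + d) % m ≡ t′ n % m
    t′-periodic-d n rewrite sym (t≡t′ (n + d)) | sym (t≡t′ n) = t-periodic n
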